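{- Let $w$ be a minimal element of $\mathcal{C}_n$, let $\mathrm{Row}_2(P(w)) = \{z_1 < \cdots < z_t\}$, and for each $i$ let $b_i$ be the value that bumps $z_i$ to the second row during the construction of $P(w)$. Then $z_1 b_1 z_2 b_2 \cdots z_t b_t$ is a consecutive subsequence (occupying consecutive positions) of the one-line notation of $w$.
   Context: A permutation is fully commutative iff it avoids $321$. $P(w)$ is the RSK (row-)insertion tableau, which has at most two rows for fully commutative $w$; $\mathrm{Row}_2(P(w))$ is the set of its second-row entries. A set $L$ of integers is crowded if there exist integers $x>0$, $y$ with $|[y,y+2x]\cap L|>x+1$. $\mathcal{C}_n$ is the set of fully commutative $w\in S_n$ with $\mathrm{Row}_2(P(w))$ crowded, and minimal means minimal in $\mathcal{C}_n$ with respect to the right weak order (the transitive closure of $u<us_i$ whenever $\ell(us_i)>\ell(u)$). -}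

module Defs where

open import Data.Nat using (ℕ; zero; suc; _+_; _<_; _<?_; _≤_)
open import Data.Nat.Properties using (_≟_)
open import Data.Integer as ℤ using (ℤ; +_)
open import Data.List using (List; []; _∷_; _++_; length; filter; map; foldl; concatMap; upTo)
open import Data.List.Relation.Binary.Permutation.Propositional using (_↭_)
open import Data.List.Relation.Binary.Sublist.Propositional using (_⊆_)
open import Data.Maybe using (Maybe; just; nothing)
open import Data.Product using (_×_; _,_; proj₁; ∃; ∃-syntax)
open import Relation.Nullary using (¬_; yes; no)
open import Relation.Nullary.Decidable using (_×-dec_)
open import Relation.Binary.PropositionalEquality using (_≡_)
open import Relation.Binary.Construct.Closure.Transitive using (TransClosure)

-- Permutations of [1..n] in one-line notation: w = w(1) w(2) ... w(n).
IsPerm : ℕ → List ℕ → Set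
IsPerm n w = w ↭ map suc (upTo n)

-- Fully commutative = 321-avoiding: no subsequence c b a with c > b > a.
FullyCommutative : List ℕ → Set
FullyCommutative w = ∀ a b c → (c ∷ b ∷ a ∷ []) ⊆ w → ¬ (a < b × b < c)

-- Tableaux as lists of rows (row 1 first), each row increasing.
Tableau : Set
Tableau = List (List ℕ)

insertRow : ℕ → List ℕ → Maybe ℕ × List ℕ
insertRow x [] = nothing , (x ∷ [])
insertRow x (y ∷ r) with x <? y
... | yes _ = just y , (x ∷ r)
... | no _ with insertRow x r
...   | (m , r') = m , (y ∷ r')

insertTab : ℕ → Tableau → Tableau
insertTab x [] = (x ∷ []) ∷ []
insertTab x (r ∷ rs) with insertRow x r
... | (nothing , r') = r' ∷ rs
... | (just y , r') = r' ∷ insertTab y rs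

P : List ℕ → Tableau
P w = foldl (λ T x → insertTab x T) [] w

row2 : Tableau → List ℕ
row2 (_ ∷ r ∷ _) = r
row2 _ = []

firstBump : ℕ → Tableau → Maybe ℕ
firstBump x [] = nothing
firstBump x (r ∷ _) = proj₁ (insertRow x r)

bumpEventsFrom : Tableau → List ℕ → List (ℕ × ℕ)
bumpEventsFrom T [] = []
bumpEventsFrom T (x ∷ xs) with firstBump x T
... | nothing = bumpEventsFrom (insertTab x T) xs
... | just y = (y , x) ∷ bumpEventsFrom (insertTab x T) xs

bumpEvents : List ℕ → List (ℕ × ℕ)
bumpEvents w = bumpEventsFrom [] w

-- The value that bumps z into the second row (first such event; 0 if none).
bumperIn : List (ℕ × ℕ) → ℕ → ℕ
bumperIn [] z = 0
bumperIn ((y , x) ∷ es) z with y ≟ z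
... | yes _ = x
... | no _ = bumperIn es z

bumper : List ℕ → ℕ → ℕ
bumper w z = bumperIn (bumpEvents w) z

countIn : ℤ → ℤ → List ℕ → ℕ
countIn lo hi L = length (filter (λ z → (lo ℤ.≤? + z) ×-dec (+ z ℤ.≤? hi)) L)

Crowded : List ℕ → Set
Crowded L = ∃[ x ] ∃[ y ] (0 < x × x + 1 < countIn y (y ℤ.+ + (2 Data.Nat.* x)) L)

InC : ℕ → List ℕ → Set
InC n w = IsPerm n w × FullyCommutative w × Crowded (row2 (P w))

-- Right multiplication by s_{i+1}: swap positions i, i+1 (0-based) in one-line notation.
swapAt : ℕ → List ℕ → List ℕ
swapAt zero (a ∷ b ∷ r) = b ∷ a ∷ r
swapAt (suc i) (a ∷ r) = a ∷ swapAt i r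
swapAt _ w = w

-- Coxeter length = number of inversions.
len : List ℕ → ℕ
len [] = 0
len (x ∷ xs) = length (filter (λ y → y <? x) xs) + len xs

-- Generating relation of right weak order: u < u s_i when ℓ(u s_i) > ℓ(u).
-- (Out-of-range swaps are the identity and are excluded by the strict inequality.)
WeakStep : List ℕ → List ℕ → Set
WeakStep u v = ∃[ i ] (v ≡ swapAt i u × len u < len v)

_<W_ : List ℕ → List ℕ → Set
u <W v = TransClosure WeakStep u v

MinimalInC : ℕ → List ℕ → Set
MinimalInC n w = InC n w × (∀ u → InC n u → ¬ (u <W w))

interleaveBumpers : List ℕ → List ℕ
interleaveBumpers w = concatMap (λ z → z ∷ bumper w z ∷ []) (row2 (P w))

module Submission where

-- If the bottom x of a descent ℓ x of w did not bump ℓ itself out of the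
-- first row, the Knuth relation would give P (w with ℓ x swapped) = P w, contradicting minimality.
-- Hence P w has the descent tops as second row, each bumped by its descent bottom, and
-- interleaveBumpers w lists the descent pairs z b of w in order; since w avoids 321 they do not
-- overlap. They are contiguous: if a descent z b were followed by an ascent and later by a descent,
-- then swapping z b deletes z from the second row, swapping the last descent a c deletes a, and both
-- results leave C_n. But the letters of the later descents are distinct values in (z , a], so a − z
-- exceeds twice the number of second-row entries after z, and with that spacing a crowded window of
-- the second row survives one of the two deletions.

open import Defs
open import Data.Nat using (ℕ; zero; suc; _+_; _*_; _∸_; _<_; _>_; _<?_; _≤_; z≤n; s≤s)
open import Data.Nat.Properties
open import Data.List using (List; []; _∷_; _++_; [_]; initLast; _∷ʳ′_; length; filter; map; foldl; concatMap; reverse)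
open import Data.List.Properties
  using (++-assoc; ++-identityʳ; ++-conicalʳ; ∷ʳ-injective; foldl-++; foldl-∷ʳ; unfold-reverse; reverse-involutive;
         map-++; length-map; length-++; filter-accept; filter-reject; filter-all; filter-++)
open import Data.List.Relation.Unary.All as All using (All; []; _∷_)
open import Data.List.Relation.Unary.All.Properties
  using (all-filter; ∷ʳ⁺; ++⁻ˡ; ++⁻ʳ) renaming (filter⁺ to All-filter⁺; ++⁺ to All-++⁺; map⁻ to All-map⁻)
open import Data.Integer as ℤ using (ℤ; +_)
import Data.Integer.Properties as ℤP
import Data.Integer.Tactic.RingSolver as ℤ-Solver
open import Relation.Nullary.Decidable using (_×-dec_; ¬?)
open import Function.Bundles using (_⇔_; mk⇔; module Equivalence)
open import Data.Maybe using (just; nothing)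
open import Data.Product using (_×_; _,_; proj₁; proj₂; ∃-syntax)
open import Data.Sum as Sum using (_⊎_; inj₁; inj₂)
open import Data.Empty using (⊥; ⊥-elim)
open import Relation.Nullary using (¬_; Dec; yes; no)
open import Relation.Binary.PropositionalEquality
  using (_≡_; _≢_; ≢-sym; refl; sym; trans; cong; cong₂; subst; subst₂; setoid; module ≡-Reasoning)
open import Data.List.Relation.Unary.AllPairs as AllPairs using (AllPairs; []; _∷_)
open import Data.List.Relation.Unary.Linked as Linked using (Linked; [-]; _∷_)
open import Data.List.Relation.Unary.Unique.Propositional using (Unique)
open import Data.List.Relation.Unary.Any using (here; there)
open import Data.List.Relation.Unary.Any.Properties using (reverse⁺)
open import Data.List.Membership.Propositional using (_∈_)
open import Data.List.Membership.Propositional.Properties using (∈-++⁺ˡ; ∈-++⁺ʳ)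
import Data.List.Relation.Unary.Unique.Propositional.Properties as Unique
open import Data.List.Relation.Binary.Permutation.Propositional using (_↭_; ↭-sym; ↭-trans; ↭⇒↭ₛ)
open import Data.List.Relation.Binary.Permutation.Propositional.Properties using (++⁺ˡ; filter-↭; ↭-length)
import Data.List.Relation.Binary.Permutation.Setoid.Properties as PermSetoid
open import Data.List.Relation.Binary.Sublist.Propositional using (_⊆_; []; _∷_; _∷ʳ_; minimum; from∈; ⊆-refl)
import Data.List.Relation.Binary.Sublist.Propositional.Properties as Sublist
import Relation.Binary.Construct.Closure.Transitive as TransClosure
open import Data.Nat.Tactic.RingSolver using (solve-∀)

∷≢[] : ∀ {A : Set} {x : A} {xs : List A} → x ∷ xs ≢ []
∷≢[] ()

AllPairs-resp-⊇ : ∀ {A : Set} {R : A → A → Set} {xs ys} → xs ⊆ ys → AllPairs R ys → AllPairs R xs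
AllPairs-resp-⊇ [] [] = []
AllPairs-resp-⊇ (y ∷ʳ τ) (_ ∷ Rys) = AllPairs-resp-⊇ τ Rys
AllPairs-resp-⊇ (refl ∷ τ) (Ry ∷ Rys) = Sublist.All-resp-⊆ τ Ry ∷ AllPairs-resp-⊇ τ Rys

AllPairs-++-∷⇒Allˡ : ∀ {A : Set} {R : A → A → Set} xs {z ys} → AllPairs R (xs ++ z ∷ ys) → All (λ x → R x z) xs
AllPairs-++-∷⇒Allˡ [] _ = []
AllPairs-++-∷⇒Allˡ (x ∷ xs) (Rx ∷ Rxs) = All.lookup Rx (∈-++⁺ʳ xs (here refl)) ∷ AllPairs-++-∷⇒Allˡ xs Rxs

AllPairs-++-∷⇒Allʳ : ∀ {A : Set} {R : A → A → Set} xs {z ys} → AllPairs R (xs ++ z ∷ ys) → All (R z) ys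
AllPairs-++-∷⇒Allʳ [] (Rz ∷ _) = Rz
AllPairs-++-∷⇒Allʳ (x ∷ xs) (_ ∷ Rxs) = AllPairs-++-∷⇒Allʳ xs Rxs

AllPairs-∷ʳ⁺ : ∀ {A : Set} {R : A → A → Set} {xs x} → AllPairs R xs → All (λ y → R y x) xs → AllPairs R (xs ++ [ x ])
AllPairs-∷ʳ⁺ [] [] = [] ∷ []
AllPairs-∷ʳ⁺ (Rx ∷ Rxs) (Rxx ∷ Rxsx) = ∷ʳ⁺ Rx Rxx ∷ AllPairs-∷ʳ⁺ Rxs Rxsx

AllPairs-<-≤last : ∀ {L A a} → AllPairs _<_ L → L ≡ A ++ [ a ] → All (_≤ a) L
AllPairs-<-≤last {A = A} {a} increasing refl = ∷ʳ⁺ (All.map <⇒≤ (AllPairs-++-∷⇒Allˡ A increasing)) ≤-refl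

All≤-snoc : ∀ {K ℓ x} → All (_≤ ℓ) K → ℓ ≤ x → All (_≤ x) (K ++ [ ℓ ])
All≤-snoc K≤ℓ ℓ≤x = ∷ʳ⁺ (All.map (λ k≤ℓ → ≤-trans k≤ℓ ℓ≤x) K≤ℓ) ℓ≤x

permutation-unique : ∀ {n w} → IsPerm n w → Unique w
permutation-unique {n} w↭ =
  PermSetoid.Unique-resp-↭ (setoid ℕ) (↭⇒↭ₛ (↭-sym w↭)) (Unique.map⁺ suc-injective (Unique.upTo⁺ n))

-- Row insertion

-- An empty row is no row at all, as in the tableaux built by insertTab.
oneRow : List ℕ → Tableau
oneRow [] = []
oneRow (z ∷ zs) = (z ∷ zs) ∷ []

twoRows : List ℕ → List ℕ → Tableau
twoRows R Z = R ∷ oneRow Z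

row2-twoRows : ∀ R Z → row2 (twoRows R Z) ≡ Z
row2-twoRows R [] = refl
row2-twoRows R (z ∷ Z) = refl

insertRow-append : ∀ {x R} → All (_≤ x) R → insertRow x R ≡ (nothing , R ++ [ x ])
insertRow-append {x} {[]} [] = refl
insertRow-append {x} {y ∷ R} (y≤x ∷ R≤x) with x <? y
... | yes x<y = ⊥-elim (<⇒≱ x<y y≤x)
... | no _ rewrite insertRow-append R≤x = refl

insertRow-bump : ∀ {x y hi} lo → All (_≤ x) lo → x < y → insertRow x (lo ++ y ∷ hi) ≡ (just y , lo ++ x ∷ hi)
insertRow-bump {x} {y} [] [] x<y with x <? y
... | yes _ = refl
... | no x≮y = ⊥-elim (x≮y x<y)
insertRow-bump {x} {y} {hi} (l ∷ lo) (l≤x ∷ lo≤x) x<y with x <? l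
... | yes x<l = ⊥-elim (<⇒≱ x<l l≤x)
... | no _ rewrite insertRow-bump {x} {y} {hi} lo lo≤x x<y = refl

insertRow-noBump⇒All≤ : ∀ {x R R'} → insertRow x R ≡ (nothing , R') → All (_≤ x) R
insertRow-noBump⇒All≤ {x} {[]} _ = []
insertRow-noBump⇒All≤ {x} {y ∷ R} eq with x <? y
... | yes _ with () ← eq
... | no x≮y with insertRow x R in eqR
... | (nothing , _) = ≮⇒≥ x≮y ∷ insertRow-noBump⇒All≤ eqR
... | (just _ , _) with () ← eq

insertRow-bump-++ : ∀ {x y R R'} t → insertRow x R ≡ (just y , R') → insertRow x (R ++ t) ≡ (just y , R' ++ t)
insertRow-bump-++ {x} {R = z ∷ R} t eq with x <? z
... | yes _ with refl ← eq = refl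
insertRow-bump-++ {x} {R = z ∷ R} t eq | no _ with insertRow x R in eqR
... | (just _ , _) with refl ← eq rewrite insertRow-bump-++ {x} {R = R} t eqR = refl
... | (nothing , _) with () ← eq

insertRow-bump-All : ∀ {x y R R'} {Q : ℕ → Set} → insertRow x R ≡ (just y , R') → All Q R → Q x → All Q R'
insertRow-bump-All {x} {R = z ∷ R} eq (qz ∷ qR) qx with x <? z
... | yes _ with refl ← eq = qx ∷ qR
... | no _ with insertRow x R in eqR
... | (just _ , _) with refl ← eq = qz ∷ insertRow-bump-All eqR qR qx
... | (nothing , _) with () ← eq

insertTab-noBump : ∀ {x r r'} rs → insertRow x r ≡ (nothing , r') → insertTab x (r ∷ rs) ≡ r' ∷ rs
insertTab-noBump rs eq rewrite eq = refl

insertTab-bump : ∀ {x y r r'} rs → insertRow x r ≡ (just y , r') → insertTab x (r ∷ rs) ≡ r' ∷ insertTab y rs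
insertTab-bump rs eq rewrite eq = refl

insertTab-oneRow : ∀ {y} Z → All (_≤ y) Z → insertTab y (oneRow Z) ≡ oneRow (Z ++ [ y ])
insertTab-oneRow [] _ = refl
insertTab-oneRow (z ∷ Z) Z≤y rewrite insertRow-append Z≤y = refl

-- An instance of a Knuth relation.
insertTab-comm : ∀ {x ℓ y K K'} Z → All (_≤ ℓ) K → x ≤ ℓ → insertRow x K ≡ (just y , K') →
  insertTab x (insertTab ℓ (twoRows K Z)) ≡ insertTab ℓ (insertTab x (twoRows K Z))
insertTab-comm {x} {ℓ} {y} {K} {K'} Z K≤ℓ x≤ℓ eq
  rewrite insertTab-noBump {ℓ} {K} (oneRow Z) (insertRow-append K≤ℓ)
        | insertTab-bump {x} {y} {K ++ [ ℓ ]} (oneRow Z) (insertRow-bump-++ {x} {y} {K} [ ℓ ] eq)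
        | insertTab-bump {x} {y} {K} (oneRow Z) eq
        | insertTab-noBump {ℓ} {K'} (insertTab y (oneRow Z)) (insertRow-append (insertRow-bump-All eq K≤ℓ x≤ℓ)) = refl

insertAll : Tableau → List ℕ → Tableau
insertAll = foldl (λ T x → insertTab x T)

P-++ : ∀ p s → P (p ++ s) ≡ insertAll (P p) s
P-++ = foldl-++ (λ T x → insertTab x T) []

P-swap-comm : ∀ p {K Z x ℓ y K'} s → P p ≡ twoRows K Z → All (_≤ ℓ) K → x ≤ ℓ → insertRow x K ≡ (just y , K') →
  P (p ++ x ∷ ℓ ∷ s) ≡ P (p ++ ℓ ∷ x ∷ s)
P-swap-comm p {K} {Z} s Pp K≤ℓ x≤ℓ bumps = begin
  P (p ++ _ ∷ _ ∷ s)                                  ≡⟨ P-++ p _ ⟩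
  insertAll (insertTab _ (insertTab _ (P p))) s        ≡⟨ cong (λ T → insertAll (insertTab _ (insertTab _ T)) s) Pp ⟩
  insertAll (insertTab _ (insertTab _ (twoRows K Z))) s ≡⟨ cong (λ T → insertAll T s) (insertTab-comm Z K≤ℓ x≤ℓ bumps) ⟨
  insertAll (insertTab _ (insertTab _ (twoRows K Z))) s ≡⟨ cong (λ T → insertAll (insertTab _ (insertTab _ T)) s) Pp ⟨
  insertAll (insertTab _ (insertTab _ (P p))) s        ≡⟨ P-++ p _ ⟨
  P (p ++ _ ∷ _ ∷ s)                                  ∎
  where open ≡-Reasoning

bumpEventsFrom-bump : ∀ {x y T} s → firstBump x T ≡ just y →
  bumpEventsFrom T (x ∷ s) ≡ (y , x) ∷ bumpEventsFrom (insertTab x T) s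
bumpEventsFrom-bump s bumps rewrite bumps = refl

bumpEventsFrom-noBump : ∀ {x T} s → firstBump x T ≡ nothing → bumpEventsFrom T (x ∷ s) ≡ bumpEventsFrom (insertTab x T) s
bumpEventsFrom-noBump s noBump rewrite noBump = refl

-- Descent swaps and the weak order

swapAt-length : ∀ (p : List ℕ) {a c s} → swapAt (length p) (p ++ c ∷ a ∷ s) ≡ p ++ a ∷ c ∷ s
swapAt-length [] = refl
swapAt-length (x ∷ p) = cong (x ∷_) (swapAt-length p)

swap-↭ : ∀ (p : List ℕ) {a c s} → p ++ a ∷ c ∷ s ↭ p ++ c ∷ a ∷ s
swap-↭ p {a} {c} = ++⁺ˡ p (_↭_.swap a c _↭_.refl)

len-swap-< : ∀ (p : List ℕ) {a c s} → c < a → len (p ++ c ∷ a ∷ s) < len (p ++ a ∷ c ∷ s)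
len-swap-< [] {a} {c} {s} c<a
  rewrite filter-reject (_<? c) {a} {s} (<-asym c<a) | filter-accept (_<? a) {c} {s} c<a =
  s≤s (≤-reflexive (swap-middle (length (filter (_<? c) s)) (length (filter (_<? a) s)) (len s)))
  where
  swap-middle : ∀ i j k → i + (j + k) ≡ j + (i + k)
  swap-middle = solve-∀
len-swap-< (y ∷ p) {a} {c} {s} c<a =
  subst (λ k → k + len (p ++ c ∷ a ∷ s) < smaller (p ++ a ∷ c ∷ s) + len (p ++ a ∷ c ∷ s))
    (↭-length (filter-↭ (_<? y) (swap-↭ p {a} {c} {s})))
    (+-monoʳ-< (smaller (p ++ a ∷ c ∷ s)) (len-swap-< p c<a))
  where
  smaller : List ℕ → ℕ
  smaller xs = length (filter (_<? y) xs)

descending-⊆-swap : ∀ (p : List ℕ) {a c s σ} → c < a → Linked _>_ σ → σ ⊆ p ++ c ∷ a ∷ s → σ ⊆ p ++ a ∷ c ∷ s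
descending-⊆-swap [] c<a _ (_ ∷ʳ (_ ∷ʳ τ)) = _ ∷ʳ (_ ∷ʳ τ)
descending-⊆-swap [] c<a _ (_ ∷ʳ (refl ∷ τ)) = refl ∷ (_ ∷ʳ τ)
descending-⊆-swap [] c<a _ (refl ∷ (_ ∷ʳ τ)) = _ ∷ʳ (refl ∷ τ)
descending-⊆-swap [] c<a (c>a ∷ _) (refl ∷ (refl ∷ τ)) = ⊥-elim (<-asym c<a c>a)
descending-⊆-swap (x ∷ p) c<a σ↓ (_ ∷ʳ τ) = x ∷ʳ descending-⊆-swap p c<a σ↓ τ
descending-⊆-swap (x ∷ p) c<a σ↓ (refl ∷ τ) = refl ∷ descending-⊆-swap p c<a (Linked.tail σ↓) τ

FullyCommutative-swap : ∀ (p : List ℕ) {a c s} → c < a →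
  FullyCommutative (p ++ a ∷ c ∷ s) → FullyCommutative (p ++ c ∷ a ∷ s)
FullyCommutative-swap p c<a fc x y z τ (x<y , y<z) =
  fc x y z (descending-⊆-swap p c<a (y<z ∷ x<y ∷ [-]) τ) (x<y , y<z)

FullyCommutative-noDoubleDescent : ∀ {w} → FullyCommutative w →
  ∀ (p : List ℕ) {a b c s} → w ≡ p ++ a ∷ b ∷ c ∷ s → c < b → ¬ b < a
FullyCommutative-noDoubleDescent fc p {a} {b} {c} refl c<b b<a =
  fc c b a (Sublist.++⁺ˡ p (refl ∷ refl ∷ refl ∷ minimum _)) (c<b , b<a)

-- The only consequence of minimality that the argument needs.
LocallyMinimal : List ℕ → Set
LocallyMinimal w = ∀ (p : List ℕ) {a c s} → w ≡ p ++ a ∷ c ∷ s → c < a → ¬ Crowded (row2 (P (p ++ c ∷ a ∷ s)))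

minimal⇒locallyMinimal : ∀ {n w} → MinimalInC n w → LocallyMinimal w
minimal⇒locallyMinimal ((w↭ , fc , _) , minimal) p refl c<a crowded =
  minimal (p ++ _ ∷ _ ∷ _) (↭-trans (↭-sym (swap-↭ p)) w↭ , FullyCommutative-swap p c<a fc , crowded)
    TransClosure.[ length p , sym (swapAt-length p) , len-swap-< p c<a ]

-- Descents

descentsFrom : ℕ → List ℕ → List (ℕ × ℕ)
descentsFrom ℓ [] = []
descentsFrom ℓ (x ∷ s) with x <? ℓ
... | yes _ = (ℓ , x) ∷ descentsFrom x s
... | no _ = descentsFrom x s

descents : List ℕ → List (ℕ × ℕ)
descents [] = []
descents (x ∷ s) = descentsFrom x s

descentsFrom-asc : ∀ {ℓ x} s → ¬ x < ℓ → descentsFrom ℓ (x ∷ s) ≡ descentsFrom x s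
descentsFrom-asc {ℓ} {x} s x≮ℓ with x <? ℓ
... | yes x<ℓ = ⊥-elim (x≮ℓ x<ℓ)
... | no _ = refl

descentsFrom-descending : ∀ ℓ s → All (λ e → proj₂ e < proj₁ e) (descentsFrom ℓ s)
descentsFrom-descending ℓ [] = []
descentsFrom-descending ℓ (x ∷ s) with x <? ℓ
... | yes x<ℓ = x<ℓ ∷ descentsFrom-descending x s
... | no _ = descentsFrom-descending x s

tops : List (ℕ × ℕ) → List ℕ
tops = map proj₁

flatten : List (ℕ × ℕ) → List ℕ
flatten [] = []
flatten ((a , b) ∷ E) = a ∷ b ∷ flatten E

flatten-All : ∀ {Q : ℕ → Set} E → All (λ e → Q (proj₁ e) × Q (proj₂ e)) E → All Q (flatten E)
flatten-All [] [] = []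
flatten-All ((a , b) ∷ E) ((qa , qb) ∷ qE) = qa ∷ qb ∷ flatten-All E qE

length-flatten : ∀ E → length (flatten E) ≡ 2 * length E
length-flatten [] = refl
length-flatten (_ ∷ E) = trans (cong (λ k → suc (suc k)) (length-flatten E)) (sym (*-distribˡ-+ 2 1 (length E)))

tops-descentsFrom-⊆ : ∀ ℓ s → tops (descentsFrom ℓ s) ⊆ ℓ ∷ s
tops-descentsFrom-⊆ ℓ [] = ℓ ∷ʳ []
tops-descentsFrom-⊆ ℓ (x ∷ s) with x <? ℓ
... | yes _ = refl ∷ tops-descentsFrom-⊆ x s
... | no _ = ℓ ∷ʳ tops-descentsFrom-⊆ x s

tops-descents-⊆ : ∀ w → tops (descents w) ⊆ w
tops-descents-⊆ [] = []
tops-descents-⊆ (x ∷ s) = tops-descentsFrom-⊆ x s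

lastDescent : ∀ ℓ s → descentsFrom ℓ s ≢ [] →
  ∃[ q ] ∃[ a ] ∃[ c ] ∃[ s' ] (ℓ ∷ s ≡ q ++ a ∷ c ∷ s' × c < a × descentsFrom c s' ≡ [])
lastDescent ℓ [] nonempty = ⊥-elim (nonempty refl)
lastDescent ℓ (x ∷ s) nonempty with descentsFrom x s in later
... | _ ∷ _ with lastDescent x s (λ none → ∷≢[] (trans (sym later) none))
...   | (q , a , c , s' , eq , c<a , none) = ℓ ∷ q , a , c , s' , cong (ℓ ∷_) eq , c<a , none
lastDescent ℓ (x ∷ s) nonempty | [] with x <? ℓ
... | yes x<ℓ = [] , ℓ , x , s , refl , x<ℓ , later
... | no _ = ⊥-elim (nonempty later)

module _ {w : List ℕ} (fc : FullyCommutative w)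
  (descent-gap : ∀ (q : List ℕ) {z b m b' r} → w ≡ q ++ z ∷ b ∷ m ∷ b' ∷ r → b < z → ¬ b' < m →
                 descentsFrom b' r ≡ [])
  where

  descentsFrom-after-descent : ∀ (q : List ℕ) {z b} r → w ≡ q ++ z ∷ b ∷ r → b < z →
    ∃[ ys ] (r ≡ flatten (descentsFrom b r) ++ ys)
  descentsFrom-after-descent q [] _ _ = [] , refl
  descentsFrom-after-descent q {z} {b} (m ∷ r) eq b<z
    rewrite descentsFrom-asc {b} r (λ m<b → FullyCommutative-noDoubleDescent fc q eq m<b b<z) = continue r eq
    where
    continue : ∀ r → w ≡ q ++ z ∷ b ∷ m ∷ r → ∃[ ys ] (m ∷ r ≡ flatten (descentsFrom m r) ++ ys)
    continue [] _ = [ m ] , refl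
    continue (b' ∷ r) eq with b' <? m
    ... | yes b'<m =
      let (ys , e) = descentsFrom-after-descent (q ++ z ∷ b ∷ []) r (trans eq (sym (++-assoc q _ _))) b'<m
      in ys , cong (λ t → m ∷ b' ∷ t) e
    ... | no b'≮m rewrite descent-gap q eq b<z b'≮m = m ∷ b' ∷ r , refl

  descentsFrom-infix : ∀ pre ℓ s → w ≡ pre ++ ℓ ∷ s →
    ∃[ xs ] ∃[ ys ] (ℓ ∷ s ≡ xs ++ flatten (descentsFrom ℓ s) ++ ys)
  descentsFrom-infix pre ℓ [] _ = [ ℓ ] , [] , refl
  descentsFrom-infix pre ℓ (x ∷ s) eq with x <? ℓ
  ... | yes x<ℓ =
    let (ys , e) = descentsFrom-after-descent pre s eq x<ℓ
    in [] , ys , cong (λ t → ℓ ∷ x ∷ t) e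
  ... | no _ =
    let (xs , ys , e) = descentsFrom-infix (pre ++ [ ℓ ]) x s (trans eq (sym (++-assoc pre [ ℓ ] (x ∷ s))))
    in ℓ ∷ xs , ys , cong (ℓ ∷_) e

  descents-infix : ∃[ xs ] ∃[ ys ] (w ≡ xs ++ flatten (descents w) ++ ys)
  descents-infix = go w refl
    where
    go : ∀ v → w ≡ v → ∃[ xs ] ∃[ ys ] (v ≡ xs ++ flatten (descents v) ++ ys)
    go [] _ = [] , [] , refl
    go (ℓ ∷ s) eq = descentsFrom-infix [] ℓ s eq

bumperIn-hit : ∀ E a b → bumperIn ((a , b) ∷ E) a ≡ b
bumperIn-hit E a b with a ≟ a
... | yes _ = refl
... | no a≢a = ⊥-elim (a≢a refl)

bumperIn-skip : ∀ E {a b z} → a ≢ z → bumperIn ((a , b) ∷ E) z ≡ bumperIn E z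
bumperIn-skip E {a} {b} {z} a≢z with a ≟ z
... | yes a≡z = ⊥-elim (a≢z a≡z)
... | no _ = refl

bumperIn-++ : ∀ E₁ {E z} → All (_≢ z) (tops E₁) → bumperIn (E₁ ++ E) z ≡ bumperIn E z
bumperIn-++ [] _ = refl
bumperIn-++ ((a , b) ∷ E₁) (a≢z ∷ rest) = trans (bumperIn-skip (E₁ ++ _) a≢z) (bumperIn-++ E₁ rest)

interleave-bumperIn : ∀ E₁ E₂ → Unique (tops (E₁ ++ E₂)) →
  concatMap (λ z → z ∷ [ bumperIn (E₁ ++ E₂) z ]) (tops E₂) ≡ flatten E₂
interleave-bumperIn E₁ [] _ = refl
interleave-bumperIn E₁ ((a , b) ∷ E₂) uniq = cong₂ (λ v r → a ∷ v ∷ r) hit rest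
  where
  hit : bumperIn (E₁ ++ (a , b) ∷ E₂) a ≡ b
  hit = trans (bumperIn-++ E₁ (AllPairs-++-∷⇒Allˡ (tops E₁) (subst Unique (map-++ proj₁ E₁ _) uniq)))
              (bumperIn-hit E₂ a b)
  shift : (E₁ ++ [ (a , b) ]) ++ E₂ ≡ E₁ ++ (a , b) ∷ E₂
  shift = ++-assoc E₁ [ (a , b) ] E₂
  rest : concatMap (λ z → z ∷ [ bumperIn (E₁ ++ (a , b) ∷ E₂) z ]) (tops E₂) ≡ flatten E₂
  rest = subst (λ E → concatMap (λ z → z ∷ [ bumperIn E z ]) (tops E₂) ≡ flatten E₂) shift
           (interleave-bumperIn (E₁ ++ [ (a , b) ]) E₂ (subst (λ E → Unique (tops E)) (sym shift) uniq))

-- Crowded sets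

-- v ∈ [z - d , z), written without truncated subtraction.
InWindow : ℕ → ℕ → ℕ → Set
InWindow d z v = z ≤ v + d × v < z

removeAll : ℕ → List ℕ → List ℕ
removeAll z = filter (λ v → ¬? (v ≟ z))

Unique-length≤suc-removeAll : ∀ z V → Unique V → length V ≤ suc (length (removeAll z V))
Unique-length≤suc-removeAll z [] _ = z≤n
Unique-length≤suc-removeAll z (v ∷ V) (v∉V ∷ uniq) with v ≟ z
... | yes refl = ≤-reflexive (cong suc (sym (begin
  length (removeAll z (z ∷ V)) ≡⟨ cong length (filter-reject (λ u → ¬? (u ≟ z)) (λ z≢z → z≢z refl)) ⟩
  length (removeAll z V)       ≡⟨ cong length (filter-all (λ u → ¬? (u ≟ z)) (All.map ≢-sym v∉V)) ⟩
  length V                     ∎)))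
  where open ≡-Reasoning
... | no v≢z = subst (λ k → suc (length V) ≤ suc k) (sym (cong length (filter-accept (λ u → ¬? (u ≟ z)) v≢z)))
                (s≤s (Unique-length≤suc-removeAll z V uniq))

Unique-window-length≤ : ∀ d z V → Unique V → All (InWindow d z) V → length V ≤ d
Unique-window-length≤ d z [] _ _ = z≤n
Unique-window-length≤ zero z (v ∷ V) _ ((z≤v+0 , v<z) ∷ _) = ⊥-elim (<⇒≱ v<z (subst (z ≤_) (+-identityʳ v) z≤v+0))
Unique-window-length≤ (suc d) zero (v ∷ V) _ ((_ , ()) ∷ _)
Unique-window-length≤ (suc d) (suc z) V uniq inWindow =
  ≤-trans (Unique-length≤suc-removeAll z V uniq)
    (s≤s (Unique-window-length≤ d z (removeAll z V) (Unique.filter⁺ ≢z? uniq)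
      (All.zipWith shrink (All-filter⁺ ≢z? inWindow , all-filter ≢z? V))))
  where
  ≢z? = λ v → ¬? (v ≟ z)
  shrink : ∀ {v} → InWindow (suc d) (suc z) v × v ≢ z → InWindow d z v
  shrink {v} ((z<v+sd , v≤z) , v≢z) = ≤-pred (subst (suc z ≤_) (+-suc v d) z<v+sd) , ≤∧≢⇒< (≤-pred v≤z) v≢z

Unique-between-length≤ : ∀ {z a} V → Unique V → All (λ v → z < v × v ≤ a) V → length V ≤ a ∸ z
Unique-between-length≤ {z} {a} V uniq between = Unique-window-length≤ (a ∸ z) (suc a) V uniq (All.map inWindow between)
  where
  inWindow : ∀ {v} → z < v × v ≤ a → InWindow (a ∸ z) (suc a) v
  inWindow {v} (z<v , v≤a) =
    subst (_≤ v + (a ∸ z)) (cong suc (m+[n∸m]≡n (≤-trans (<⇒≤ z<v) v≤a))) (+-monoˡ-≤ (a ∸ z) z<v) , s≤s v≤a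

InInterval : ℤ → ℤ → ℕ → Set
InInterval lo hi v = lo ℤ.≤ + v × + v ℤ.≤ hi

inInterval? : ∀ lo hi v → Dec (InInterval lo hi v)
inInterval? lo hi v = (lo ℤ.≤? + v) ×-dec (+ v ℤ.≤? hi)

countIn-++ : ∀ lo hi A B → countIn lo hi (A ++ B) ≡ countIn lo hi A + countIn lo hi B
countIn-++ lo hi A B = trans (cong length (filter-++ (inInterval? lo hi) A B)) (length-++ (filter (inInterval? lo hi) A))

countIn-∷-in : ∀ {lo hi v} B → InInterval lo hi v → countIn lo hi (v ∷ B) ≡ suc (countIn lo hi B)
countIn-∷-in {lo} {hi} B v∈ = cong length (filter-accept (inInterval? lo hi) v∈)

countIn-∷-out : ∀ {lo hi v} B → ¬ InInterval lo hi v → countIn lo hi (v ∷ B) ≡ countIn lo hi B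
countIn-∷-out {lo} {hi} B v∉ = cong length (filter-reject (inInterval? lo hi) v∉)

countIn-all : ∀ {lo hi} T → All (InInterval lo hi) T → countIn lo hi T ≡ length T
countIn-all {lo} {hi} T T⊆I = cong length (filter-all (inInterval? lo hi) T⊆I)

countIn-mono : ∀ {lo hi lo' hi'} {Q : ℕ → Set} A → All Q A →
  (∀ {v} → Q v → InInterval lo hi v → InInterval lo' hi' v) → countIn lo hi A ≤ countIn lo' hi' A
countIn-mono [] [] _ = z≤n
countIn-mono {lo} {hi} {lo'} {hi'} (v ∷ A) (qv ∷ qA) moves with inInterval? lo hi v | inInterval? lo' hi' v
... | yes v∈ | _ = subst₂ _≤_ (sym (countIn-∷-in A v∈)) (sym (countIn-∷-in A (moves qv v∈))) (s≤s (countIn-mono A qA moves))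
... | no v∉ | yes v∈' =
  subst₂ _≤_ (sym (countIn-∷-out A v∉)) (sym (countIn-∷-in A v∈')) (m≤n⇒m≤1+n (countIn-mono A qA moves))
... | no v∉ | no v∉' = subst₂ _≤_ (sym (countIn-∷-out A v∉)) (sym (countIn-∷-out A v∉')) (countIn-mono A qA moves)

countIn-window : ∀ {lo hi} {Q : ℕ → Set} d z A → Unique A → All Q A →
  (∀ {v} → Q v → InInterval lo hi v → InWindow d z v) → countIn lo hi A ≤ d
countIn-window {lo} {hi} d z A uniq qA inWindow =
  Unique-window-length≤ d z (filter (inInterval? lo hi) A) (Unique.filter⁺ (inInterval? lo hi) uniq)
    (All.zipWith (λ (qv , v∈) → inWindow qv v∈) (All-filter⁺ (inInterval? lo hi) qA , all-filter (inInterval? lo hi) A))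

ℤ≤+⇒distance : ∀ {y z} → y ℤ.≤ + z → ∃[ d ] (y ℤ.+ + d ≡ + z)
ℤ≤+⇒distance {y} {z} y≤z =
  ℤ.∣ + z ℤ.- y ∣ , trans (cong (λ k → y ℤ.+ k) (ℤP.0≤i⇒+∣i∣≡i (ℤP.i≤j⇒0≤j-i y≤z))) (y+[z-y]≡z y (+ z))
  where
  y+[z-y]≡z : ∀ y z → y ℤ.+ (z ℤ.- y) ≡ z
  y+[z-y]≡z = ℤ-Solver.solve-∀

ℤ-+-cancelʳ-≤ : ∀ {i j} k → i ℤ.+ k ℤ.≤ j ℤ.+ k → i ℤ.≤ j
ℤ-+-cancelʳ-≤ {i} {j} k le = subst₂ ℤ._≤_ (i+k-k≡i i k) (i+k-k≡i j k) (ℤP.+-monoˡ-≤ (ℤ.- k) le)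
  where
  i+k-k≡i : ∀ i k → (i ℤ.+ k) ℤ.+ ℤ.- k ≡ i
  i+k-k≡i = ℤ-Solver.solve-∀

-- Shifting by the distance d from the left end y to z turns membership in [y , y + m] into ℕ arithmetic.
inInterval⇔ : ∀ {y z d m v} → y ℤ.+ + d ≡ + z → InInterval y (y ℤ.+ + m) v ⇔ (z ≤ v + d × v + d ≤ z + m)
inInterval⇔ {y} {z} {d} {m} {v} y+d≡z = mk⇔ to from
  where
  right-end : (y ℤ.+ + m) ℤ.+ + d ≡ + (z + m)
  right-end = trans (swap y (+ m) (+ d)) (trans (cong (λ k → k ℤ.+ + m) y+d≡z) (sym (ℤP.pos-+ z m)))
    where
    swap : ∀ y m d → (y ℤ.+ m) ℤ.+ d ≡ (y ℤ.+ d) ℤ.+ m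
    swap = ℤ-Solver.solve-∀
  to : InInterval y (y ℤ.+ + m) v → z ≤ v + d × v + d ≤ z + m
  to (y≤v , v≤y+m) =
    ℤP.drop‿+≤+ (subst₂ ℤ._≤_ y+d≡z (sym (ℤP.pos-+ v d)) (ℤP.+-monoˡ-≤ (+ d) y≤v)) ,
    ℤP.drop‿+≤+ (subst₂ ℤ._≤_ (sym (ℤP.pos-+ v d)) right-end (ℤP.+-monoˡ-≤ (+ d) v≤y+m))
  from : z ≤ v + d × v + d ≤ z + m → InInterval y (y ℤ.+ + m) v
  from (z≤v+d , v+d≤z+m) =
    ℤ-+-cancelʳ-≤ (+ d) (subst₂ ℤ._≤_ (sym y+d≡z) (ℤP.pos-+ v d) (ℤ.+≤+ z≤v+d)) ,
    ℤ-+-cancelʳ-≤ (+ d) (subst₂ ℤ._≤_ (ℤP.pos-+ v d) (sym right-end) (ℤ.+≤+ v+d≤z+m))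

crowding-arithmetic : ∀ {x t d c} → suc (2 * t) + d ≤ 2 * x → c ≤ d → x + 1 < c + suc t →
  ∃[ x' ] (0 < x' × x' + 1 < c × d ≤ suc (2 * x'))
crowding-arithmetic {x} {t} {d} {c} wide c≤d dense = witness c c≤d 3+d≤2c
  where
  x+1≤c+t : x + 1 ≤ c + t
  x+1≤c+t = ≤-pred (subst (suc (x + 1) ≤_) (+-suc c t) dense)
  3+d≤2c : 3 + d ≤ 2 * c
  3+d≤2c = +-cancelˡ-≤ (2 * t) _ _ (begin
    2 * t + (3 + d)      ≡⟨ rearrange t d ⟩
    (suc (2 * t) + d) + 2 ≤⟨ +-monoˡ-≤ 2 wide ⟩
    2 * x + 2            ≡⟨ *-distribˡ-+ 2 x 1 ⟨
    2 * (x + 1)          ≤⟨ *-monoʳ-≤ 2 x+1≤c+t ⟩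
    2 * (c + t)          ≡⟨ *-distribˡ-+ 2 c t ⟩
    2 * c + 2 * t        ≡⟨ +-comm (2 * c) (2 * t) ⟩
    2 * t + 2 * c        ∎)
    where
    open ≤-Reasoning
    rearrange : ∀ t d → 2 * t + (3 + d) ≡ (suc (2 * t) + d) + 2
    rearrange = solve-∀
  witness : ∀ c → c ≤ d → 3 + d ≤ 2 * c → ∃[ x' ] (0 < x' × x' + 1 < c × d ≤ suc (2 * x'))
  witness 0 _ ()
  witness 1 _ (s≤s (s≤s ()))
  witness 2 (s≤s (s≤s _)) (s≤s (s≤s (s≤s (s≤s ()))))
  witness (suc (suc (suc c'))) _ bound =
    suc c' , s≤s z≤n , s≤s (≤-reflexive (+-comm (suc c') 1)) ,
    +-cancelˡ-≤ 3 _ _ (subst (3 + d ≤_) (double c') bound)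
    where
    double : ∀ c' → 2 * suc (suc (suc c')) ≡ 3 + suc (2 * suc c')
    double = solve-∀

-- If z and all of T lie in a crowded window of A ++ z ∷ T, while T reaches far above z,
-- then the window can be moved entirely below z and stays crowded.
crowded-below : ∀ A T {x y z a} → Unique A → All (_< z) A →
  InInterval y (y ℤ.+ + (2 * x)) z → InInterval y (y ℤ.+ + (2 * x)) a →
  All (InInterval y (y ℤ.+ + (2 * x))) T → z + suc (2 * length T) ≤ a →
  x + 1 < countIn y (y ℤ.+ + (2 * x)) (A ++ z ∷ T) → Crowded (A ++ T)
crowded-below A T {x} {y} {z} {a} uniqA A<z z∈ a∈ T∈ far dense with ℤ≤+⇒distance (proj₁ z∈)
... | (d , y+d≡z) = shifted (crowding-arithmetic wide cA≤d (subst (x + 1 <_) count dense))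
  where
  hi = y ℤ.+ + (2 * x)
  t = length T
  cA = countIn y hi A
  count : countIn y hi (A ++ z ∷ T) ≡ cA + suc t
  count = trans (countIn-++ y hi A (z ∷ T)) (cong (λ k → cA + k) (trans (countIn-∷-in T z∈) (cong suc (countIn-all T T∈))))
  cA≤d : cA ≤ d
  cA≤d = countIn-window d z A uniqA A<z (λ v<z v∈ → proj₁ (Equivalence.to (inInterval⇔ y+d≡z) v∈) , v<z)
  wide : suc (2 * t) + d ≤ 2 * x
  wide = +-cancelˡ-≤ z _ _ (≤-trans (subst (_≤ a + d) (+-assoc z (suc (2 * t)) d) (+-monoˡ-≤ d far))
                                    (proj₂ (Equivalence.to (inInterval⇔ y+d≡z) a∈)))
  shifted : ∃[ x' ] (0 < x' × x' + 1 < cA × d ≤ suc (2 * x')) → Crowded (A ++ T)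
  shifted (x' , 0<x' , x'+1<cA , d≤1+2x') =
    x' , y' , 0<x' , <-≤-trans x'+1<cA (≤-trans (countIn-mono A A<z moves) countIn-A≤)
    where
    y' = + z ℤ.- + suc (2 * x')
    hi' = y' ℤ.+ + (2 * x')
    y'+1+2x'≡z : y' ℤ.+ + suc (2 * x') ≡ + z
    y'+1+2x'≡z = k-l+l (+ z) (+ suc (2 * x'))
      where
      k-l+l : ∀ k l → (k ℤ.- l) ℤ.+ l ≡ k
      k-l+l = ℤ-Solver.solve-∀
    moves : ∀ {v} → v < z → InInterval y hi v → InInterval y' hi' v
    moves {v} v<z v∈ = Equivalence.from (inInterval⇔ y'+1+2x'≡z)
      (≤-trans (proj₁ (Equivalence.to (inInterval⇔ y+d≡z) v∈)) (+-monoʳ-≤ v d≤1+2x') ,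
       subst (_≤ z + 2 * x') (sym (+-suc v (2 * x'))) (+-monoˡ-≤ (2 * x') v<z))
    countIn-A≤ : countIn y' hi' A ≤ countIn y' hi' (A ++ T)
    countIn-A≤ = subst (countIn y' hi' A ≤_) (sym (countIn-++ y' hi' A T)) (m≤m+n _ _)

crowded-survives-deletion : ∀ A T' {z a} → Unique A → All (_< z) A → All (z <_) (T' ++ [ a ]) →
  All (_≤ a) T' → z + suc (2 * length (T' ++ [ a ])) ≤ a →
  Crowded (A ++ z ∷ T' ++ [ a ]) → Crowded (A ++ T' ++ [ a ]) ⊎ Crowded (A ++ z ∷ T')
crowded-survives-deletion A T' {z} {a} uniqA A<z z<T T'≤a far (x , y , 0<x , dense)
  with inInterval? y (y ℤ.+ + (2 * x)) z | inInterval? y (y ℤ.+ + (2 * x)) a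
... | no z∉ | _ = inj₁ (x , y , 0<x , subst (x + 1 <_) without-z dense)
  where
  without-z : countIn y (y ℤ.+ + (2 * x)) (A ++ z ∷ T' ++ [ a ]) ≡ countIn y (y ℤ.+ + (2 * x)) (A ++ T' ++ [ a ])
  without-z = trans (countIn-++ y _ A _) (trans (cong (λ k → countIn y _ A + k) (countIn-∷-out (T' ++ [ a ]) z∉))
                                                (sym (countIn-++ y _ A _)))
... | yes _ | no a∉ = inj₂ (x , y , 0<x , subst (x + 1 <_) without-a dense)
  where
  hi = y ℤ.+ + (2 * x)
  without-a : countIn y hi (A ++ z ∷ T' ++ [ a ]) ≡ countIn y hi (A ++ z ∷ T')
  without-a = begin
    countIn y hi (A ++ z ∷ T' ++ [ a ])             ≡⟨ cong (countIn y hi) (++-assoc A (z ∷ T') [ a ]) ⟨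
    countIn y hi ((A ++ z ∷ T') ++ [ a ])           ≡⟨ countIn-++ y hi (A ++ z ∷ T') [ a ] ⟩
    countIn y hi (A ++ z ∷ T') + countIn y hi [ a ] ≡⟨ cong (λ k → countIn y hi (A ++ z ∷ T') + k) (countIn-∷-out [] a∉) ⟩
    countIn y hi (A ++ z ∷ T') + 0                  ≡⟨ +-identityʳ _ ⟩
    countIn y hi (A ++ z ∷ T')                      ∎
    where open ≡-Reasoning
... | yes z∈ | yes a∈ = inj₁ (crowded-below A (T' ++ [ a ]) uniqA A<z z∈ a∈ (T-in T' z<T T'≤a) far dense)
  where
  T-in : ∀ T' → All (z <_) (T' ++ [ a ]) → All (_≤ a) T' → All (InInterval y (y ℤ.+ + (2 * x))) (T' ++ [ a ])
  T-in [] (z<a ∷ []) [] = (ℤP.≤-trans (proj₁ z∈) (ℤ.+≤+ (<⇒≤ z<a)) , proj₂ a∈) ∷ []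
  T-in (v ∷ T') (z<v ∷ z<T) (v≤a ∷ T'≤a) =
    (ℤP.≤-trans (proj₁ z∈) (ℤ.+≤+ (<⇒≤ z<v)) , ℤP.≤-trans (ℤ.+≤+ v≤a) (proj₂ a∈)) ∷ T-in T' z<T T'≤a

crowded-deletions : ∀ {L A T A₂ z a} → AllPairs _<_ L → L ≡ A ++ z ∷ T → L ≡ A₂ ++ [ a ] → T ≢ [] →
  z + suc (2 * length T) ≤ a → Crowded L → Crowded (A ++ T) ⊎ Crowded A₂
crowded-deletions {L} {A} {T} {A₂} {z} {a} increasing L≡AzT L≡A₂a nonempty far crowdedL with initLast T
... | [] = ⊥-elim (nonempty refl)
... | T' ∷ʳ′ a' with ∷ʳ-injective (A ++ z ∷ T') A₂ (trans (++-assoc A (z ∷ T') [ a' ]) (trans (sym L≡AzT) L≡A₂a))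
...   | (AzT'≡A₂ , refl) =
  Sum.map₂ (subst Crowded AzT'≡A₂)
    (crowded-survives-deletion A T' (AllPairs.map <⇒≢ (AllPairs-resp-⊇ (Sublist.++⁺ʳ _ ⊆-refl) increasing'))
      (AllPairs-++-∷⇒Allˡ A increasing') (AllPairs-++-∷⇒Allʳ A increasing') T'≤a far (subst Crowded L≡AzT crowdedL))
  where
  increasing' : AllPairs _<_ (A ++ z ∷ T' ++ [ a' ])
  increasing' = subst (AllPairs _<_) L≡AzT increasing
  T'≤a : All (_≤ a') T'
  T'≤a = All.map <⇒≤ (All.tail (++⁻ʳ A (AllPairs-++-∷⇒Allˡ (A ++ z ∷ T')
           (subst (AllPairs _<_) (sym (++-assoc A (z ∷ T') [ a' ])) increasing'))))

-- Tableaux of prefixes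

-- A prefix of w is handled reversed, as ℓ ∷ rp with last letter ℓ, so that extending it is a cons.
reverse-∷-++ : ∀ ℓ rp (s : List ℕ) → reverse (ℓ ∷ rp) ++ s ≡ reverse rp ++ ℓ ∷ s
reverse-∷-++ ℓ rp s rewrite unfold-reverse ℓ rp = ++-assoc (reverse rp) [ ℓ ] s

P-snoc : ∀ x rp → P (reverse (x ∷ rp)) ≡ insertTab x (P (reverse rp))
P-snoc x rp rewrite unfold-reverse x rp = foldl-∷ʳ (λ T x → insertTab x T) [] x (reverse rp)

-- For a fully commutative minimal w, a prefix reversed to ℓ ∷ rp has insertion tableau
-- twoRows (firstRowInit ℓ rp ++ [ ℓ ]) (secondRow ℓ rp): the descent tops move to the second row.
firstRowInit : ℕ → List ℕ → List ℕ
firstRowInit ℓ [] = []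
firstRowInit ℓ (ℓ' ∷ rp) with ℓ <? ℓ'
... | yes _ = firstRowInit ℓ' rp
... | no _ = firstRowInit ℓ' rp ++ [ ℓ' ]

secondRow : ℕ → List ℕ → List ℕ
secondRow ℓ [] = []
secondRow ℓ (ℓ' ∷ rp) with ℓ <? ℓ'
... | yes _ = secondRow ℓ' rp ++ [ ℓ' ]
... | no _ = secondRow ℓ' rp

prefixDescents : ℕ → List ℕ → List (ℕ × ℕ)
prefixDescents ℓ [] = []
prefixDescents ℓ (ℓ' ∷ rp) with ℓ <? ℓ'
... | yes _ = prefixDescents ℓ' rp ++ [ (ℓ' , ℓ) ]
... | no _ = prefixDescents ℓ' rp

firstRowInit-desc : ∀ {ℓ ℓ'} rp → ℓ < ℓ' → firstRowInit ℓ (ℓ' ∷ rp) ≡ firstRowInit ℓ' rp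
firstRowInit-desc {ℓ} {ℓ'} rp ℓ<ℓ' with ℓ <? ℓ'
... | yes _ = refl
... | no ℓ≮ℓ' = ⊥-elim (ℓ≮ℓ' ℓ<ℓ')

firstRowInit-asc : ∀ {ℓ ℓ'} rp → ¬ ℓ < ℓ' → firstRowInit ℓ (ℓ' ∷ rp) ≡ firstRowInit ℓ' rp ++ [ ℓ' ]
firstRowInit-asc {ℓ} {ℓ'} rp ℓ≮ℓ' with ℓ <? ℓ'
... | yes ℓ<ℓ' = ⊥-elim (ℓ≮ℓ' ℓ<ℓ')
... | no _ = refl

secondRow-desc : ∀ {ℓ ℓ'} rp → ℓ < ℓ' → secondRow ℓ (ℓ' ∷ rp) ≡ secondRow ℓ' rp ++ [ ℓ' ]
secondRow-desc {ℓ} {ℓ'} rp ℓ<ℓ' with ℓ <? ℓ'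
... | yes _ = refl
... | no ℓ≮ℓ' = ⊥-elim (ℓ≮ℓ' ℓ<ℓ')

secondRow-asc : ∀ {ℓ ℓ'} rp → ¬ ℓ < ℓ' → secondRow ℓ (ℓ' ∷ rp) ≡ secondRow ℓ' rp
secondRow-asc {ℓ} {ℓ'} rp ℓ≮ℓ' with ℓ <? ℓ'
... | yes ℓ<ℓ' = ⊥-elim (ℓ≮ℓ' ℓ<ℓ')
... | no _ = refl

tops-prefixDescents : ∀ ℓ rp → tops (prefixDescents ℓ rp) ≡ secondRow ℓ rp
tops-prefixDescents ℓ [] = refl
tops-prefixDescents ℓ (ℓ' ∷ rp) with ℓ <? ℓ'
... | yes _ = trans (map-++ proj₁ (prefixDescents ℓ' rp) _) (cong (_++ [ ℓ' ]) (tops-prefixDescents ℓ' rp))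
... | no _ = tops-prefixDescents ℓ' rp

descents-reverse-++ : ∀ rp ℓ s → descents (reverse (ℓ ∷ rp) ++ s) ≡ prefixDescents ℓ rp ++ descentsFrom ℓ s
descents-reverse-++ [] ℓ s = refl
descents-reverse-++ (ℓ' ∷ rp) ℓ s rewrite reverse-∷-++ ℓ (ℓ' ∷ rp) s | descents-reverse-++ rp ℓ' (ℓ ∷ s)
  with ℓ <? ℓ'
... | yes _ = sym (++-assoc (prefixDescents ℓ' rp) _ (descentsFrom ℓ s))
... | no _ = refl

PrefixShape : ℕ → List ℕ → Set
PrefixShape ℓ rp = P (reverse (ℓ ∷ rp)) ≡ twoRows (firstRowInit ℓ rp ++ [ ℓ ]) (secondRow ℓ rp)
  × All (_≤ ℓ) (firstRowInit ℓ rp) × All (_∈ rp) (secondRow ℓ rp) × AllPairs _≤_ (secondRow ℓ rp)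

-- The tableau Tu of the word with a descent (z , b) of w swapped, read as far as the reversed prefix
-- ℓ ∷ rp of w: it is the tableau of that prefix of w with z moved from the second row back into the
-- first row, between lo and hi.
SwappedShape : ℕ → List ℕ → ℕ → List ℕ → Tableau → List ℕ → Set
SwappedShape z A ℓ rp Tu B = ∃[ lo ] ∃[ hi ]
  (firstRowInit ℓ rp ++ [ ℓ ] ≡ lo ++ hi) × (secondRow ℓ rp ≡ A ++ z ∷ B) × (Tu ≡ twoRows (lo ++ z ∷ hi) (A ++ B))
  × All (_≤ z) lo × All (z ≤_) hi × (hi ≡ [] → B ≡ []) × All (_≤ z) A

module _ {w : List ℕ} (fc : FullyCommutative w) (uniq : Unique w)
  (crowded : Crowded (row2 (P w))) (locallyMinimal : LocallyMinimal w) where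

  noDoubleDescent : ∀ (p : List ℕ) {a b c s} → w ≡ p ++ a ∷ b ∷ c ∷ s → c < b → ¬ b < a
  noDoubleDescent = FullyCommutative-noDoubleDescent fc

  descentSwap-changes-P : ∀ (p : List ℕ) {a c s} → w ≡ p ++ a ∷ c ∷ s → c < a → P (p ++ c ∷ a ∷ s) ≢ P w
  descentSwap-changes-P p eq c<a same = locallyMinimal p eq c<a (subst (λ T → Crowded (row2 T)) (sym same) crowded)

  before-descent-≤ : ∀ (p : List ℕ) {ℓ x s z} → w ≡ p ++ ℓ ∷ x ∷ s → x < ℓ → z ∈ p → z ≤ ℓ
  before-descent-≤ p {ℓ} {x} {s} {z} refl x<ℓ z∈p = ≮⇒≥ λ ℓ<z →
    fc x ℓ z (Sublist.++⁺ (from∈ z∈p) (refl ∷ refl ∷ minimum s)) (x<ℓ , ℓ<z)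

  secondRow≤descentTop : ∀ rp {ℓ x s} → w ≡ reverse rp ++ ℓ ∷ x ∷ s → x < ℓ →
    ∀ {Z} → All (_∈ rp) Z → All (_≤ ℓ) Z
  secondRow≤descentTop rp eq x<ℓ = All.map (λ z∈rp → before-descent-≤ (reverse rp) eq x<ℓ (reverse⁺ z∈rp))

  prefix-shape : ∀ rp ℓ s → w ≡ reverse (ℓ ∷ rp) ++ s → PrefixShape ℓ rp
  -- In a minimal w, the bottom x of a descent ℓ x bumps ℓ itself out of the first row.
  firstRowInit≤descentBottom : ∀ rp ℓ x s → w ≡ reverse (ℓ ∷ rp) ++ x ∷ s → x < ℓ → All (_≤ x) (firstRowInit ℓ rp)

  prefix-shape [] ℓ s eq = refl , [] , [] , []
  prefix-shape (ℓ' ∷ rp) ℓ s eq with prefix-shape rp ℓ' (ℓ ∷ s) (trans eq (reverse-∷-++ ℓ (ℓ' ∷ rp) s)) | ℓ <? ℓ'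
  ... | (shape , K≤ℓ' , Z∈rp , Z-sorted) | yes ℓ<ℓ' =
    trans (P-snoc ℓ (ℓ' ∷ rp)) (trans (cong (insertTab ℓ) shape)
      (trans (insertTab-bump {ℓ} {ℓ'} {K ++ [ ℓ' ]} (oneRow Z) (insertRow-bump {hi = []} K K≤ℓ ℓ<ℓ'))
             (cong ((K ++ [ ℓ ]) ∷_) (insertTab-oneRow Z Z≤ℓ')))) ,
    K≤ℓ , ∷ʳ⁺ (All.map there Z∈rp) (here refl) , AllPairs-∷ʳ⁺ Z-sorted Z≤ℓ'
    where
    K = firstRowInit ℓ' rp
    Z = secondRow ℓ' rp
    eq' : w ≡ reverse (ℓ' ∷ rp) ++ ℓ ∷ s
    eq' = trans eq (reverse-∷-++ ℓ (ℓ' ∷ rp) s)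
    K≤ℓ = firstRowInit≤descentBottom rp ℓ' ℓ s eq' ℓ<ℓ'
    Z≤ℓ' = secondRow≤descentTop rp (trans eq' (reverse-∷-++ ℓ' rp (ℓ ∷ s))) ℓ<ℓ' Z∈rp
  ... | (shape , K≤ℓ' , Z∈rp , Z-sorted) | no ℓ≮ℓ' =
    trans (P-snoc ℓ (ℓ' ∷ rp)) (trans (cong (insertTab ℓ) shape)
      (insertTab-noBump {ℓ} {firstRowInit ℓ' rp ++ [ ℓ' ]} (oneRow (secondRow ℓ' rp)) (insertRow-append Kℓ'≤ℓ))) ,
    Kℓ'≤ℓ , All.map there Z∈rp , Z-sorted
    where
    Kℓ'≤ℓ = All≤-snoc K≤ℓ' (≮⇒≥ ℓ≮ℓ')

  firstRowInit≤descentBottom [] ℓ x s eq x<ℓ = []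
  firstRowInit≤descentBottom (ℓ' ∷ rp) ℓ x s eq x<ℓ with ℓ <? ℓ'
  ... | yes ℓ<ℓ' = ⊥-elim (noDoubleDescent (reverse rp) (trans eq' (reverse-∷-++ ℓ' rp (ℓ ∷ x ∷ s))) x<ℓ ℓ<ℓ')
    where
    eq' : w ≡ reverse (ℓ' ∷ rp) ++ ℓ ∷ x ∷ s
    eq' = trans eq (reverse-∷-++ ℓ (ℓ' ∷ rp) (x ∷ s))
  ... | no ℓ≮ℓ' with insertRow x (firstRowInit ℓ' rp ++ [ ℓ' ]) in bumps
  ...   | (nothing , _) = insertRow-noBump⇒All≤ bumps
  ...   | (just _ , _) = ⊥-elim (descentSwap-changes-P (reverse (ℓ' ∷ rp)) eq' x<ℓ
          (trans (P-swap-comm (reverse (ℓ' ∷ rp)) s shape Kℓ'≤ℓ (<⇒≤ x<ℓ) bumps) (cong P (sym eq'))))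
    where
    eq' : w ≡ reverse (ℓ' ∷ rp) ++ ℓ ∷ x ∷ s
    eq' = trans eq (reverse-∷-++ ℓ (ℓ' ∷ rp) (x ∷ s))
    shape-rp = prefix-shape rp ℓ' (ℓ ∷ x ∷ s) eq'
    shape = proj₁ shape-rp
    Kℓ'≤ℓ = All≤-snoc (proj₁ (proj₂ shape-rp)) (≮⇒≥ ℓ≮ℓ')

  bumpEventsFrom-prefix : ∀ rp ℓ s → w ≡ reverse (ℓ ∷ rp) ++ s →
    bumpEventsFrom (P (reverse (ℓ ∷ rp))) s ≡ descentsFrom ℓ s
  bumpEventsFrom-snoc : ∀ rp ℓ x s → w ≡ reverse (ℓ ∷ rp) ++ x ∷ s →
    bumpEventsFrom (insertTab x (P (reverse (ℓ ∷ rp)))) s ≡ descentsFrom x s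
  bumpEventsFrom-prefix rp ℓ [] eq = refl
  bumpEventsFrom-prefix rp ℓ (x ∷ s) eq with prefix-shape rp ℓ (x ∷ s) eq | x <? ℓ
  ... | (shape , _) | yes x<ℓ =
    trans (bumpEventsFrom-bump {T = P (reverse (ℓ ∷ rp))} s (trans (cong (firstBump x) shape)
            (cong proj₁ (insertRow-bump {hi = []} (firstRowInit ℓ rp) (firstRowInit≤descentBottom rp ℓ x s eq x<ℓ) x<ℓ))))
          (cong ((ℓ , x) ∷_) (bumpEventsFrom-snoc rp ℓ x s eq))
  ... | (shape , K≤ℓ , _) | no x≮ℓ =
    trans (bumpEventsFrom-noBump {T = P (reverse (ℓ ∷ rp))} s
            (trans (cong (firstBump x) shape) (cong proj₁ (insertRow-append Kℓ≤x))))
          (bumpEventsFrom-snoc rp ℓ x s eq)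
    where
    Kℓ≤x = All≤-snoc K≤ℓ (≮⇒≥ x≮ℓ)

  bumpEventsFrom-snoc rp ℓ x s eq =
    subst (λ T → bumpEventsFrom T s ≡ descentsFrom x s) (P-snoc x (ℓ ∷ rp))
      (bumpEventsFrom-prefix (ℓ ∷ rp) x s (trans eq (sym (reverse-∷-++ x (ℓ ∷ rp) s))))

  bumpEvents≡descents : bumpEvents w ≡ descents w
  bumpEvents≡descents = go w refl
    where
    go : ∀ v → w ≡ v → bumpEvents v ≡ descents v
    go [] _ = refl
    go (ℓ ∷ s) eq = bumpEventsFrom-prefix [] ℓ s eq

  whole-word : w ≡ [] ⊎ ∃[ ℓ ] ∃[ rp ] (w ≡ reverse (ℓ ∷ rp) ++ [])
  whole-word with reverse w in rev
  ... | [] = inj₁ (trans (sym (reverse-involutive w)) (cong reverse rev))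
  ... | ℓ ∷ rp = inj₂ (ℓ , rp , trans (sym (reverse-involutive w)) (trans (cong reverse rev) (sym (++-identityʳ _))))

  row2-whole : ∀ {ℓ rp} → w ≡ reverse (ℓ ∷ rp) ++ [] → row2 (P w) ≡ secondRow ℓ rp
  row2-whole {ℓ} {rp} w≡ = begin
    row2 (P w)                                            ≡⟨ cong (λ v → row2 (P v)) (trans w≡ (++-identityʳ _)) ⟩
    row2 (P (reverse (ℓ ∷ rp)))                           ≡⟨ cong row2 (proj₁ (prefix-shape rp ℓ [] w≡)) ⟩
    row2 (twoRows (firstRowInit ℓ rp ++ [ ℓ ]) (secondRow ℓ rp)) ≡⟨ row2-twoRows _ (secondRow ℓ rp) ⟩
    secondRow ℓ rp                                        ∎
    where open ≡-Reasoning

  row2≡tops-descents : row2 (P w) ≡ tops (descents w)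
  row2≡tops-descents with whole-word
  ... | inj₁ w≡[] = subst (λ v → row2 (P v) ≡ tops (descents v)) (sym w≡[]) refl
  ... | inj₂ (ℓ , rp , w≡) = begin
    row2 (P w)                                    ≡⟨ row2-whole {ℓ} {rp} w≡ ⟩
    secondRow ℓ rp                                ≡⟨ tops-prefixDescents ℓ rp ⟨
    tops (prefixDescents ℓ rp)                    ≡⟨ cong tops (++-identityʳ _) ⟨
    tops (prefixDescents ℓ rp ++ descentsFrom ℓ []) ≡⟨ cong tops (descents-reverse-++ rp ℓ []) ⟨
    tops (descents (reverse (ℓ ∷ rp) ++ []))      ≡⟨ cong (λ v → tops (descents v)) w≡ ⟨
    tops (descents w)                             ∎
    where open ≡-Reasoning

  row2-increasing : AllPairs _<_ (row2 (P w))
  row2-increasing = AllPairs.zipWith (λ (x≤y , x≢y) → ≤∧≢⇒< x≤y x≢y) (sorted , distinct)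
    where
    distinct : Unique (row2 (P w))
    distinct = subst Unique (sym row2≡tops-descents) (AllPairs-resp-⊇ (tops-descents-⊆ w) uniq)
    sorted : AllPairs _≤_ (row2 (P w))
    sorted with whole-word
    ... | inj₁ w≡[] = subst (λ v → AllPairs _≤_ (row2 (P v))) (sym w≡[]) []
    ... | inj₂ (ℓ , rp , w≡) =
      subst (AllPairs _≤_) (sym (row2-whole {ℓ} {rp} w≡)) (proj₂ (proj₂ (proj₂ (prefix-shape rp ℓ [] w≡))))

  swapped-collapse : ∀ {z A x s rp ℓ Tu B} → w ≡ reverse (ℓ ∷ rp) ++ x ∷ s → SwappedShape z A ℓ rp Tu B →
    ¬ x < ℓ → x < z → insertAll Tu (x ∷ s) ≡ P w
  swapped-collapse {z} {A} {x} {s} {rp} {ℓ} eq (lo , hi , row1 , row2≡ , refl , lo≤z , z≤hi , hi≡[]⇒B≡[] , A≤z) x≮ℓ x<z =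
    finish hi row1 row2≡ z≤hi hi≡[]⇒B≡[]
    where
    Kℓ≤x : All (_≤ x) (firstRowInit ℓ rp ++ [ ℓ ])
    Kℓ≤x = All≤-snoc (proj₁ (proj₂ (prefix-shape rp ℓ (x ∷ s) eq))) (≮⇒≥ x≮ℓ)
    eq' : w ≡ reverse (x ∷ ℓ ∷ rp) ++ s
    eq' = trans eq (sym (reverse-∷-++ x (ℓ ∷ rp) s))
    finish : ∀ {B} hi → firstRowInit ℓ rp ++ [ ℓ ] ≡ lo ++ hi → secondRow ℓ rp ≡ A ++ z ∷ B →
      All (z ≤_) hi → (hi ≡ [] → B ≡ []) →
      insertAll (twoRows (lo ++ z ∷ hi) (A ++ B)) (x ∷ s) ≡ P w
    finish (h ∷ _) row1 _ (z≤h ∷ _) _ =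
      ⊥-elim (<⇒≱ x<z (≤-trans z≤h (All.lookup (subst (All (_≤ x)) row1 Kℓ≤x) (∈-++⁺ʳ lo (here refl)))))
    finish [] row1 row2≡ _ B≡[] with B≡[] refl
    ... | refl = begin
      insertAll (insertTab x (twoRows (lo ++ [ z ]) (A ++ []))) s ≡⟨ cong (λ T → insertAll T s) step ⟩
      insertAll (P (reverse (x ∷ ℓ ∷ rp))) s                   ≡⟨ P-++ (reverse (x ∷ ℓ ∷ rp)) s ⟨
      P (reverse (x ∷ ℓ ∷ rp) ++ s)                            ≡⟨ cong P eq' ⟨
      P w                                                      ∎
      where
      open ≡-Reasoning
      K≡lo : firstRowInit ℓ rp ++ [ ℓ ] ≡ lo
      K≡lo = trans row1 (++-identityʳ lo)
      step : insertTab x (twoRows (lo ++ [ z ]) (A ++ [])) ≡ P (reverse (x ∷ ℓ ∷ rp))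
      step = begin
        insertTab x (twoRows (lo ++ [ z ]) (A ++ []))  ≡⟨ cong (λ Z → insertTab x (twoRows (lo ++ [ z ]) Z)) (++-identityʳ A) ⟩
        insertTab x (twoRows (lo ++ [ z ]) A)          ≡⟨ insertTab-bump {x} {z} {lo ++ [ z ]} (oneRow A) (insertRow-bump lo (subst (All (_≤ x)) K≡lo Kℓ≤x) x<z) ⟩
        (lo ++ [ x ]) ∷ insertTab z (oneRow A)         ≡⟨ cong ((lo ++ [ x ]) ∷_) (insertTab-oneRow A A≤z) ⟩
        twoRows (lo ++ [ x ]) (A ++ [ z ])             ≡⟨ cong₂ twoRows (cong (_++ [ x ]) (trans (firstRowInit-asc rp x≮ℓ) K≡lo))
                                                                        (trans (secondRow-asc rp x≮ℓ) row2≡) ⟨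
        twoRows (firstRowInit x (ℓ ∷ rp) ++ [ x ]) (secondRow x (ℓ ∷ rp)) ≡⟨ proj₁ (prefix-shape (ℓ ∷ rp) x s eq') ⟨
        P (reverse (x ∷ ℓ ∷ rp))                       ∎

  swapped-descent-step : ∀ {z A B x s rp ℓ Tu} → w ≡ reverse (ℓ ∷ rp) ++ x ∷ s → x < ℓ → z < x →
    SwappedShape z A ℓ rp Tu B → SwappedShape z A x (ℓ ∷ rp) (insertTab x Tu) (B ++ [ ℓ ])
  swapped-descent-step {z} {A} {B} {x} {s} {rp} {ℓ} eq x<ℓ z<x (lo , hi , row1 , row2≡ , refl , lo≤z , z≤hi , _ , A≤z)
    with initLast hi
  ... | [] = ⊥-elim (<⇒≱ (<-trans z<x x<ℓ) (All.lookup lo≤z ℓ∈lo))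
    where
    ℓ∈lo : ℓ ∈ lo
    ℓ∈lo = subst (ℓ ∈_) (trans row1 (++-identityʳ lo)) (∈-++⁺ʳ (firstRowInit ℓ rp) (here refl))
  ... | hi' ∷ʳ′ h with ∷ʳ-injective (lo ++ hi') (firstRowInit ℓ rp) (trans (++-assoc lo hi' [ h ]) (sym row1))
  ...   | (lo++hi'≡K , refl) =
    lo , hi' ++ [ x ] ,
    trans (cong (_++ [ x ]) (trans (firstRowInit-desc rp x<ℓ) (sym lo++hi'≡K))) (++-assoc lo hi' [ x ]) ,
    trans (secondRow-desc rp x<ℓ) (trans (cong (_++ [ ℓ ]) row2≡) (++-assoc A (z ∷ B) [ ℓ ])) ,
    tableau , lo≤z , ∷ʳ⁺ (++⁻ˡ hi' z≤hi) (<⇒≤ z<x) ,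
    (λ hi'x≡[] → ⊥-elim (∷≢[] (++-conicalʳ hi' [ x ] hi'x≡[]))) , A≤z
    where
    lo++hi'≤x : All (_≤ x) (lo ++ hi')
    lo++hi'≤x = subst (All (_≤ x)) (sym lo++hi'≡K) (firstRowInit≤descentBottom rp ℓ x s eq x<ℓ)
    lo-z-hi'≤x : All (_≤ x) (lo ++ z ∷ hi')
    lo-z-hi'≤x = All-++⁺ (++⁻ˡ lo lo++hi'≤x) (<⇒≤ z<x ∷ ++⁻ʳ lo lo++hi'≤x)
    AzB≤ℓ : All (_≤ ℓ) (A ++ z ∷ B)
    AzB≤ℓ = subst (All (_≤ ℓ)) row2≡
      (secondRow≤descentTop rp (trans eq (reverse-∷-++ ℓ rp (x ∷ s))) x<ℓ
        (proj₁ (proj₂ (proj₂ (prefix-shape rp ℓ (x ∷ s) eq)))))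
    tableau : insertTab x (twoRows (lo ++ z ∷ hi' ++ [ ℓ ]) (A ++ B)) ≡ twoRows (lo ++ z ∷ hi' ++ [ x ]) (A ++ B ++ [ ℓ ])
    tableau = begin
      insertTab x (twoRows (lo ++ z ∷ hi' ++ [ ℓ ]) (A ++ B))   ≡⟨ cong (λ r → insertTab x (twoRows r (A ++ B))) (++-assoc lo (z ∷ hi') [ ℓ ]) ⟨
      insertTab x (twoRows ((lo ++ z ∷ hi') ++ [ ℓ ]) (A ++ B)) ≡⟨ insertTab-bump {x} {ℓ} {(lo ++ z ∷ hi') ++ [ ℓ ]} (oneRow (A ++ B))
                                                                    (insertRow-bump {hi = []} (lo ++ z ∷ hi') lo-z-hi'≤x x<ℓ) ⟩
      ((lo ++ z ∷ hi') ++ [ x ]) ∷ insertTab ℓ (oneRow (A ++ B)) ≡⟨ cong₂ _∷_ (++-assoc lo (z ∷ hi') [ x ])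
                                                                     (insertTab-oneRow (A ++ B) (All-++⁺ (++⁻ˡ A AzB≤ℓ) (All.tail (++⁻ʳ A AzB≤ℓ)))) ⟩
      (lo ++ z ∷ hi' ++ [ x ]) ∷ oneRow ((A ++ B) ++ [ ℓ ])      ≡⟨ cong (λ Z → twoRows (lo ++ z ∷ hi' ++ [ x ]) Z) (++-assoc A B [ ℓ ]) ⟩
      twoRows (lo ++ z ∷ hi' ++ [ x ]) (A ++ B ++ [ ℓ ])          ∎
      where open ≡-Reasoning

  swapped-ascent-step : ∀ {z A B x s rp ℓ Tu} → w ≡ reverse (ℓ ∷ rp) ++ x ∷ s → ¬ x < ℓ → z ≤ x →
    SwappedShape z A ℓ rp Tu B → SwappedShape z A x (ℓ ∷ rp) (insertTab x Tu) B
  swapped-ascent-step {z} {A} {B} {x} {s} {rp} {ℓ} eq x≮ℓ z≤x (lo , hi , row1 , row2≡ , refl , lo≤z , z≤hi , _ , A≤z) =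
    lo , hi ++ [ x ] ,
    trans (cong (_++ [ x ]) (trans (firstRowInit-asc rp x≮ℓ) row1)) (++-assoc lo hi [ x ]) ,
    trans (secondRow-asc rp x≮ℓ) row2≡ ,
    trans (insertTab-noBump {x} {lo ++ z ∷ hi} (oneRow (A ++ B)) (insertRow-append lo-z-hi≤x))
          (cong (λ r → twoRows r (A ++ B)) (++-assoc lo (z ∷ hi) [ x ])) ,
    lo≤z , ∷ʳ⁺ z≤hi z≤x , (λ hix≡[] → ⊥-elim (∷≢[] (++-conicalʳ hi [ x ] hix≡[]))) , A≤z
    where
    lo++hi≤x : All (_≤ x) (lo ++ hi)
    lo++hi≤x = subst (All (_≤ x)) row1
      (All≤-snoc (proj₁ (proj₂ (prefix-shape rp ℓ (x ∷ s) eq))) (≮⇒≥ x≮ℓ))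
    lo-z-hi≤x : All (_≤ x) (lo ++ z ∷ hi)
    lo-z-hi≤x = All-++⁺ (++⁻ˡ lo lo++hi≤x) (z≤x ∷ ++⁻ʳ lo lo++hi≤x)

  SwapOutcome : ℕ → List ℕ → List ℕ → Tableau → List ℕ → Set
  SwapOutcome z A B Tu T = Tu ≡ P w ⊎ (row2 (P w) ≡ A ++ z ∷ B ++ T × row2 Tu ≡ A ++ B ++ T)

  swapped-insertAll : ∀ {z A B} s rp ℓ {Tu} → w ≡ reverse (ℓ ∷ rp) ++ s → SwappedShape z A ℓ rp Tu B →
    All (λ e → z < proj₂ e) (descentsFrom ℓ s) → SwapOutcome z A B (insertAll Tu s) (tops (descentsFrom ℓ s))
  swapped-insertAll {z} {A} {B} [] rp ℓ eq (lo , hi , _ , row2≡ , refl , _) _ =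
    inj₂ (trans (row2-whole {ℓ} {rp} eq) (trans row2≡ (cong (λ t → A ++ z ∷ t) (sym (++-identityʳ B)))) ,
          trans (row2-twoRows _ (A ++ B)) (cong (A ++_) (sym (++-identityʳ B))))
  swapped-insertAll {z} {A} {B} (x ∷ s) rp ℓ eq shape bottoms>z with x <? ℓ
  ... | yes x<ℓ with bottoms>z
  ...   | z<x ∷ later>z with swapped-insertAll s (ℓ ∷ rp) x (trans eq (sym (reverse-∷-++ x (ℓ ∷ rp) s)))
                              (swapped-descent-step eq x<ℓ z<x shape) later>z
  ...     | inj₁ same = inj₁ same
  ...     | inj₂ (row2-w , row2-u) =
    inj₂ (trans row2-w (cong (λ t → A ++ z ∷ t) (++-assoc B [ ℓ ] _)) , trans row2-u (cong (A ++_) (++-assoc B [ ℓ ] _)))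
  swapped-insertAll {z} (x ∷ s) rp ℓ eq shape bottoms>z | no x≮ℓ with x <? z
  ... | yes x<z = inj₁ (swapped-collapse {rp = rp} {ℓ} eq shape x≮ℓ x<z)
  ... | no x≮z = swapped-insertAll s (ℓ ∷ rp) x (trans eq (sym (reverse-∷-++ x (ℓ ∷ rp) s)))
                   (swapped-ascent-step eq x≮ℓ (≮⇒≥ x≮z) shape) bottoms>z

  P-before-descent : ∀ rp {ℓ c s} → w ≡ reverse rp ++ ℓ ∷ c ∷ s → c < ℓ →
    insertTab c (P (reverse rp)) ≡ insertTab c (twoRows (firstRowInit ℓ rp) (secondRow ℓ rp))
  P-before-descent [] _ _ = refl
  P-before-descent (ℓ' ∷ rp) {ℓ} {c} {s} eq c<ℓ with ℓ <? ℓ'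
  ... | yes ℓ<ℓ' = ⊥-elim (noDoubleDescent (reverse rp) (trans eq (reverse-∷-++ ℓ' rp (ℓ ∷ c ∷ s))) c<ℓ ℓ<ℓ')
  ... | no _ = cong (insertTab c) (proj₁ (prefix-shape rp ℓ' (ℓ ∷ c ∷ s) eq))

  prefix-reversed : ∀ p {a c} (s : List ℕ) → p ++ a ∷ c ∷ s ≡ reverse (c ∷ a ∷ reverse p) ++ s
  prefix-reversed p {a} {c} s = begin
    p ++ a ∷ c ∷ s                     ≡⟨ cong (_++ a ∷ c ∷ s) (reverse-involutive p) ⟨
    reverse (reverse p) ++ a ∷ c ∷ s   ≡⟨ reverse-∷-++ a (reverse p) (c ∷ s) ⟨
    reverse (a ∷ reverse p) ++ c ∷ s   ≡⟨ reverse-∷-++ c (a ∷ reverse p) s ⟨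
    reverse (c ∷ a ∷ reverse p) ++ s   ∎
    where open ≡-Reasoning

  swapped-start : ∀ p {a c s} → w ≡ p ++ a ∷ c ∷ s → c < a →
    SwappedShape a (secondRow a (reverse p)) c (a ∷ reverse p) (insertAll (P p) (c ∷ [ a ])) []
  swapped-start p {a} {c} {s} eq c<a =
    K ++ [ c ] , [] ,
    trans (cong (_++ [ c ]) (firstRowInit-desc rp c<a)) (sym (++-identityʳ _)) ,
    secondRow-desc rp c<a , tableau ,
    ∷ʳ⁺ K≤a (<⇒≤ c<a) , [] , (λ _ → refl) ,
    secondRow≤descentTop rp eq-rp c<a (proj₁ (proj₂ (proj₂ shape)))
    where
    rp = reverse p
    K = firstRowInit a rp
    Z = secondRow a rp
    eq-rp : w ≡ reverse rp ++ a ∷ c ∷ s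
    eq-rp = trans eq (cong (_++ a ∷ c ∷ s) (sym (reverse-involutive p)))
    eq-a : w ≡ reverse (a ∷ rp) ++ c ∷ s
    eq-a = trans eq-rp (sym (reverse-∷-++ a rp (c ∷ s)))
    shape = prefix-shape rp a (c ∷ s) eq-a
    K≤a = proj₁ (proj₂ shape)
    tableau : insertTab a (insertTab c (P p)) ≡ twoRows ((K ++ [ c ]) ++ [ a ]) (Z ++ [])
    tableau = begin
      insertTab a (insertTab c (P p))                 ≡⟨ cong (λ v → insertTab a (insertTab c (P v))) (reverse-involutive p) ⟨
      insertTab a (insertTab c (P (reverse rp)))      ≡⟨ cong (insertTab a) (P-before-descent rp eq-rp c<a) ⟩
      insertTab a (insertTab c (twoRows K Z))         ≡⟨ cong (insertTab a) (insertTab-noBump {c} {K} (oneRow Z)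
                                                            (insertRow-append (firstRowInit≤descentBottom rp a c s eq-a c<a))) ⟩
      insertTab a (twoRows (K ++ [ c ]) Z)            ≡⟨ insertTab-noBump {a} {K ++ [ c ]} (oneRow Z) (insertRow-append (∷ʳ⁺ K≤a (<⇒≤ c<a))) ⟩
      twoRows ((K ++ [ c ]) ++ [ a ]) Z               ≡⟨ cong (twoRows _) (++-identityʳ Z) ⟨
      twoRows ((K ++ [ c ]) ++ [ a ]) (Z ++ [])       ∎
      where open ≡-Reasoning

  descentSwap-row2 : ∀ p {a c} s → w ≡ p ++ a ∷ c ∷ s → c < a → All (λ e → a < proj₂ e) (descentsFrom c s) →
    row2 (P w) ≡ secondRow a (reverse p) ++ a ∷ tops (descentsFrom c s)
    × row2 (P (p ++ c ∷ a ∷ s)) ≡ secondRow a (reverse p) ++ tops (descentsFrom c s)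
  descentSwap-row2 p s eq c<a bottoms>a
    with swapped-insertAll s (_ ∷ reverse p) _ (trans eq (prefix-reversed p s)) (swapped-start p eq c<a) bottoms>a
  ... | inj₁ same = ⊥-elim (descentSwap-changes-P p eq c<a (trans (P-++ p _) same))
  ... | inj₂ (row2-w , row2-u) = row2-w , trans (cong row2 (P-++ p _)) row2-u

  descent-next-above : ∀ q {z b m r} → w ≡ q ++ z ∷ b ∷ m ∷ r → b < z → ¬ m < b → z < m
  descent-next-above q {z} {b} {m} {r} eq b<z m≮b with m <? z
  ... | yes m<z = ⊥-elim (descentSwap-changes-P q eq b<z (trans (P-++ q _)
                    (swapped-collapse {rp = z ∷ reverse q} {b} (trans eq (prefix-reversed q (m ∷ r))) (swapped-start q eq b<z) m≮b m<z)))
  ... | no m≮z = ≤∧≢⇒< (≮⇒≥ m≮z) (All.lookup z≢later (there (here refl)))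
    where
    z≢later : All (z ≢_) (b ∷ m ∷ r)
    z≢later = AllPairs-++-∷⇒Allʳ q (subst Unique eq uniq)

  firstRowInit≤laterBottoms : ∀ {m} rp ℓ s → w ≡ reverse (ℓ ∷ rp) ++ s → m ∈ firstRowInit ℓ rp →
    All (λ e → m ≤ proj₂ e) (descentsFrom ℓ s)
  firstRowInit≤laterBottoms rp ℓ [] _ _ = []
  firstRowInit≤laterBottoms {m} rp ℓ (x ∷ s) eq m∈K with x <? ℓ
  ... | yes x<ℓ = All.lookup (firstRowInit≤descentBottom rp ℓ x s eq x<ℓ) m∈K ∷
                  firstRowInit≤laterBottoms (ℓ ∷ rp) x s eq' (subst (m ∈_) (sym (firstRowInit-desc rp x<ℓ)) m∈K)
    where
    eq' = trans eq (sym (reverse-∷-++ x (ℓ ∷ rp) s))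
  ... | no x≮ℓ = firstRowInit≤laterBottoms (ℓ ∷ rp) x s (trans eq (sym (reverse-∷-++ x (ℓ ∷ rp) s)))
                  (subst (m ∈_) (sym (firstRowInit-asc rp x≮ℓ)) (∈-++⁺ˡ m∈K))

  flatten-descentsFrom-⊆ : ∀ pre ℓ s → w ≡ pre ++ ℓ ∷ s → flatten (descentsFrom ℓ s) ⊆ ℓ ∷ s
  flatten-descentsFrom-⊆-after-descent : ∀ pre {ℓ x} s → w ≡ pre ++ ℓ ∷ x ∷ s → x < ℓ → flatten (descentsFrom x s) ⊆ s

  flatten-descentsFrom-⊆ pre ℓ [] _ = minimum _
  flatten-descentsFrom-⊆ pre ℓ (x ∷ s) eq with x <? ℓ
  ... | yes x<ℓ = refl ∷ refl ∷ flatten-descentsFrom-⊆-after-descent pre s eq x<ℓ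
  ... | no _ = ℓ ∷ʳ flatten-descentsFrom-⊆ (pre ++ [ ℓ ]) x s (trans eq (sym (++-assoc pre [ ℓ ] (x ∷ s))))

  flatten-descentsFrom-⊆-after-descent pre [] _ _ = []
  flatten-descentsFrom-⊆-after-descent pre {ℓ} {x} (y ∷ s) eq x<ℓ
    rewrite descentsFrom-asc {x} s (λ y<x → noDoubleDescent pre eq y<x x<ℓ) =
    flatten-descentsFrom-⊆ (pre ++ ℓ ∷ [ x ]) y s (trans eq (sym (++-assoc pre (ℓ ∷ [ x ]) (y ∷ s))))

  ascent-laterBottoms≥ : ∀ p {m b' r} → w ≡ p ++ m ∷ b' ∷ r → ¬ b' < m → All (λ e → m ≤ proj₂ e) (descentsFrom b' r)
  ascent-laterBottoms≥ p {m} {b'} {r} eq b'≮m =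
    firstRowInit≤laterBottoms (m ∷ reverse p) b' r (trans eq (prefix-reversed p r))
      (subst (m ∈_) (sym (firstRowInit-asc (reverse p) b'≮m)) (∈-++⁺ʳ _ (here refl)))

  descents-after-gap-span : ∀ q {z b m b' r a} → w ≡ q ++ z ∷ b ∷ m ∷ b' ∷ r → z < m → ¬ b' < m →
    descentsFrom b' r ≢ [] → All (_≤ a) (tops (descentsFrom b' r)) → z + suc (2 * length (descentsFrom b' r)) ≤ a
  descents-after-gap-span q {z} {b} {m} {b'} {r} {a} eq z<m b'≮m nonempty tops≤a = begin
    z + suc (2 * length D) ≡⟨ cong (λ k → z + suc k) (length-flatten D) ⟨
    z + length V           ≤⟨ +-monoʳ-≤ z (Unique-between-length≤ V (AllPairs-resp-⊇ V⊆w uniq) between) ⟩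
    z + (a ∸ z)            ≡⟨ m+[n∸m]≡n (≤-trans (<⇒≤ z<m) m≤a) ⟩
    a                      ∎
    where
    open ≤-Reasoning
    D = descentsFrom b' r
    V = m ∷ flatten D
    qzb = q ++ z ∷ [ b ]
    eq-m : w ≡ qzb ++ m ∷ b' ∷ r
    eq-m = trans eq (sym (++-assoc q (z ∷ [ b ]) (m ∷ b' ∷ r)))
    V⊆w : V ⊆ w
    V⊆w = subst (V ⊆_) (sym eq-m) (Sublist.++⁺ˡ qzb (refl ∷ flatten-descentsFrom-⊆ (qzb ++ [ m ]) b' r
            (trans eq-m (sym (++-assoc qzb [ m ] (b' ∷ r))))))
    chains : All (λ e → m ≤ proj₂ e × proj₂ e < proj₁ e × proj₁ e ≤ a) D
    chains = All.zip (ascent-laterBottoms≥ qzb eq-m b'≮m , All.zip (descentsFrom-descending b' r , All-map⁻ tops≤a))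
    m≤a : m ≤ a
    m≤a = first D nonempty chains
      where
      first : ∀ E → E ≢ [] → All (λ e → m ≤ proj₂ e × proj₂ e < proj₁ e × proj₁ e ≤ a) E → m ≤ a
      first [] nonempty _ = ⊥-elim (nonempty refl)
      first (_ ∷ _) _ ((m≤b , b<t , t≤a) ∷ _) = ≤-trans m≤b (≤-trans (<⇒≤ b<t) t≤a)
    between : All (λ v → z < v × v ≤ a) V
    between = (z<m , m≤a) ∷ flatten-All D (All.map (λ (m≤b , b<t , t≤a) →
      (<-≤-trans z<m (≤-trans m≤b (<⇒≤ b<t)) , t≤a) , (<-≤-trans z<m m≤b , ≤-trans (<⇒≤ b<t) t≤a)) chains)

  lastDescentSwap-row2 : ∀ p {a c s} → w ≡ p ++ a ∷ c ∷ s → c < a → descentsFrom c s ≡ [] →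
    row2 (P w) ≡ secondRow a (reverse p) ++ [ a ] × row2 (P (p ++ c ∷ a ∷ s)) ≡ secondRow a (reverse p)
  lastDescentSwap-row2 p {a} {c} {s} eq c<a none
    with descentSwap-row2 p s eq c<a (subst (All _) (sym none) [])
  ... | (row2-w , row2-u) rewrite none = row2-w , trans row2-u (++-identityʳ _)

  ¬descent-after-gap : ∀ q {z b m b' r} → w ≡ q ++ z ∷ b ∷ m ∷ b' ∷ r → b < z → ¬ b' < m →
    descentsFrom b' r ≢ [] → ⊥
  ¬descent-after-gap q {z} {b} {m} {b'} {r} eq b<z b'≮m nonempty = from-last (lastDescent b' r nonempty)
    where
    D = descentsFrom b' r
    m≮b : ¬ m < b
    m≮b m<b = noDoubleDescent q eq m<b b<z
    z<m = descent-next-above q eq b<z m≮b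
    D-eq : descentsFrom b (m ∷ b' ∷ r) ≡ D
    D-eq = trans (descentsFrom-asc (b' ∷ r) m≮b) (descentsFrom-asc r b'≮m)
    bottoms>z : All (λ e → z < proj₂ e) (descentsFrom b (m ∷ b' ∷ r))
    bottoms>z = subst (All _) (sym D-eq) (All.map (<-≤-trans z<m)
                  (ascent-laterBottoms≥ (q ++ z ∷ [ b ]) (trans eq (sym (++-assoc q (z ∷ [ b ]) _))) b'≮m))
    first-swap = descentSwap-row2 q (m ∷ b' ∷ r) eq b<z bottoms>z
    row2-w : row2 (P w) ≡ secondRow z (reverse q) ++ z ∷ tops D
    row2-w = subst (λ E → row2 (P w) ≡ _ ++ z ∷ tops E) D-eq (proj₁ first-swap)
    row2-u₁ : row2 (P (q ++ b ∷ z ∷ m ∷ b' ∷ r)) ≡ secondRow z (reverse q) ++ tops D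
    row2-u₁ = subst (λ E → row2 (P (q ++ b ∷ z ∷ m ∷ b' ∷ r)) ≡ _ ++ tops E) D-eq (proj₂ first-swap)
    tops≢[] : ∀ E → E ≢ [] → tops E ≢ []
    tops≢[] [] nonempty _ = nonempty refl
    tops≢[] (_ ∷ _) _ ()
    from-last : ∃[ q₂ ] ∃[ a ] ∃[ c ] ∃[ s₂ ] (b' ∷ r ≡ q₂ ++ a ∷ c ∷ s₂ × c < a × descentsFrom c s₂ ≡ []) → ⊥
    from-last (q₂ , a , c , s₂ , split , c<a , none) =
      Sum.[ (λ crowded₁ → locallyMinimal q eq b<z (subst Crowded (sym row2-u₁) crowded₁)) ,
            (λ crowded₂ → locallyMinimal p₂ eq₂ c<a (subst Crowded (sym (proj₂ last-swap)) crowded₂)) ]′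
        (crowded-deletions row2-increasing row2-w (proj₁ last-swap) (tops≢[] D nonempty) far crowded)
      where
      p₂ = q ++ z ∷ b ∷ m ∷ q₂
      eq₂ : w ≡ p₂ ++ a ∷ c ∷ s₂
      eq₂ = trans eq (trans (cong (λ t → q ++ z ∷ b ∷ m ∷ t) split) (sym (++-assoc q (z ∷ b ∷ m ∷ q₂) _)))
      last-swap = lastDescentSwap-row2 p₂ eq₂ c<a none
      tops≤a : All (_≤ a) (tops D)
      tops≤a = All.tail (++⁻ʳ (secondRow z (reverse q)) (subst (All (_≤ a)) row2-w
                 (AllPairs-<-≤last row2-increasing (proj₁ last-swap))))
      far : z + suc (2 * length (tops D)) ≤ a
      far = subst (λ k → z + suc (2 * k) ≤ a) (sym (length-map proj₁ D))
              (descents-after-gap-span q eq z<m b'≮m nonempty tops≤a)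

  no-descent-after-gap : ∀ q {z b m b' r} → w ≡ q ++ z ∷ b ∷ m ∷ b' ∷ r → b < z → ¬ b' < m →
    descentsFrom b' r ≡ []
  no-descent-after-gap q {b' = b'} {r} eq b<z b'≮m with descentsFrom b' r in D≡
  ... | [] = refl
  ... | _ ∷ _ = ⊥-elim (¬descent-after-gap q eq b<z b'≮m (λ none → ∷≢[] (trans (sym D≡) none)))

interleaveBumpers≡flatten-descents : ∀ {n w} → MinimalInC n w → interleaveBumpers w ≡ flatten (descents w)
interleaveBumpers≡flatten-descents {w = w} minimal@((w↭ , fc , crowded) , _) = begin
  concatMap (λ z → z ∷ [ bumperIn (bumpEvents w) z ]) (row2 (P w))
    ≡⟨ cong₂ (λ E L → concatMap (λ z → z ∷ [ bumperIn E z ]) L)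
             (bumpEvents≡descents fc uniq crowded locallyMinimal) (row2≡tops-descents fc uniq crowded locallyMinimal) ⟩
  concatMap (λ z → z ∷ [ bumperIn (descents w) z ]) (tops (descents w))
    ≡⟨ interleave-bumperIn [] (descents w) (AllPairs-resp-⊇ (tops-descents-⊆ w) uniq) ⟩
  flatten (descents w) ∎
  where
  open ≡-Reasoning
  uniq = permutation-unique w↭
  locallyMinimal = minimal⇒locallyMinimal minimal

lemma5p7 : (n : ℕ) (w : List ℕ) → MinimalInC n w →
    ∃[ xs ] ∃[ ys ] (w ≡ xs ++ interleaveBumpers w ++ ys)
lemma5p7 n w minimal@((w↭ , fc , crowded) , _) =
  let (xs , ys , w≡) = descents-infix fc
        (no-descent-after-gap fc (permutation-unique w↭) crowded (minimal⇒locallyMinimal minimal))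
  in xs , ys , trans w≡ (cong (λ t → xs ++ t ++ ys) (sym (interleaveBumpers≡flatten-descents minimal)))
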